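{- Let $f\colon\{0,1\}^{\mathbb{N}}\to\mathbb{R}$ have a continuous modulus. Then $f$ has a continuous modulus $g\colon\mathbb{N}\to\{0,1\}^{\mathbb{N}}\to\mathbb{N}$ such that for each $k\in\mathbb{N}$, $g_k$ is a modulus of itself, i.e. $\forall\alpha,\beta\in\{0,1\}^{\mathbb{N}}\,(\overline{\alpha}g_k(\alpha)=\overline{\beta}g_k(\alpha)\to g_k(\alpha)=g_k(\beta))$.
   Context: The setting is constructive (Bishop-style). For $\alpha\in\{0,1\}^{\mathbb{N}}$, $\overline{\alpha}n$ is its initial segment of length $n$. A modulus of $f\colon\{0,1\}^{\mathbb{N}}\to\mathbb{R}$ is a function $g\colon\mathbb{N}\to\{0,1\}^{\mathbb{N}}\to\mathbb{N}$, written $g_k(\alpha)$, such that for all $k,\alpha,\beta$, $\overline{\alpha}g_k(\alpha)=\overline{\beta}g_k(\alpha)$ implies $|f(\alpha)-f(\beta)|\le 2^{ -k}$. The modulus is continuous if each $g_k$ is pointwise continuous: $\forall\alpha\,\exists n\,\forall\beta\,(\overline{\alpha}n=\overline{\beta}n\to g_k(\alpha)=g_k(\beta))$. -}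

module Defs where

open import Data.Nat as ℕ using (ℕ; suc; _^_; _*_)
open import Data.Nat.Properties using (m^n≢0)
open import Data.Integer using (+_)
open import Data.Rational using (ℚ; _/_; _-_; _+_; ∣_∣; _≤_)
open import Data.Bool using (Bool)
open import Data.Vec using (Vec; tabulate)
open import Data.Fin using (toℕ)
open import Data.Product using (_×_; ∃)
open import Relation.Binary.PropositionalEquality using (_≡_)

Cantor : Set
Cantor = ℕ → Bool

prefix : Cantor → (n : ℕ) → Vec Bool n
prefix α n = tabulate (λ i → α (toℕ i))

-- Bishop real numbers: regular sequences of rationals.
-- Index i stands for Bishop's index n = i+1, so |x_m - x_n| ≤ 1/m + 1/n.
record ℝ : Set where
  field
    seq : ℕ → ℚ
    reg : ∀ m n → ∣ seq m - seq n ∣ ≤ (+ 1 / suc m) + (+ 1 / suc n)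
open ℝ public

-- Bishop: (x - y)_n = x_{2n} - y_{2n},  |z|_n = |z_n|,  and  z ≤ q  iff
-- for all n ≥ 1, z_n ≤ q + 2/n.  Unfolded with index i ↦ n = i+1 (2n ↦ 0-based 2i+1):
--   |x - y| ≤ q  iff  for all i, |x_{2i+1} - y_{2i+1}| ≤ q + 2/(i+1).
distLe : ℝ → ℝ → ℚ → Set
distLe x y q = ∀ i → ∣ seq x (suc (2 * i)) - seq y (suc (2 * i)) ∣ ≤ q + (+ 2 / suc i)

pow2neg : ℕ → ℚ
pow2neg k = _/_ (+ 1) (2 ^ k) {{m^n≢0 2 k}}

IsModulus : (Cantor → ℝ) → (ℕ → Cantor → ℕ) → Set
IsModulus f g = ∀ k α β → prefix α (g k α) ≡ prefix β (g k α) → distLe (f α) (f β) (pow2neg k)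

PointwiseContinuous : (Cantor → ℕ) → Set
PointwiseContinuous h = ∀ α → ∃ λ n → ∀ β → prefix α n ≡ prefix β n → h α ≡ h β

ContinuousModulus : (Cantor → ℝ) → (ℕ → Cantor → ℕ) → Set
ContinuousModulus f g = IsModulus f g × (∀ k → PointwiseContinuous (g k))

SelfModulating : (Cantor → ℕ) → Set
SelfModulating h = ∀ α β → prefix α (h α) ≡ prefix β (h α) → h α ≡ h β

-- For a continuous modulus G := g_{k+1}, let h α be the least n with G (ᾱn 0^ω) ≤ n.
-- Such an n exists below max (G α, c), c a modulus of continuity of G at α, and whether
-- n qualifies depends only on ᾱn, so minimality makes h self-modulating and hence
-- continuous. If ᾱ(h α) = β̄(h α), then γ := ᾱ(h α) 0^ω agrees with both α and β up to
-- G γ ≤ h α, so f α and f β are 2^-(k+1)-close to f γ and thus 2^-k-close to each other.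
module Submission where

open import Defs
open import Data.Bool using (Bool; true; false; T; if_then_else_)
open import Data.Unit using (tt)
open import Data.Nat as ℕ using (ℕ; zero; suc; NonZero; _≤_; _≤ᵇ_; _⊔_; z≤n; s≤s)
open import Data.Nat.Properties as ℕP
  using (≤-refl; ≤-antisym; ≤ᵇ⇒≤; ≤⇒≤ᵇ; m≤m⊔n; m≤n⊔m; m^n≢0)
open import Data.Nat.Tactic.RingSolver using (solve-∀)
open import Data.Integer as ℤ using (+_)
open import Data.Integer.Properties using (pos-*)
import Data.Integer.Tactic.RingSolver as ℤ-Solver
open import Data.Rational as ℚ using (_/_; _+_; _-_; ∣_∣; toℚᵘ)
open import Data.Rational.Properties
  using (fromℚᵘ-cong; toℚᵘ-injective; toℚᵘ-homo-+; toℚᵘ-fromℚᵘ; /-cong;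
         ∣p+q∣≤∣p∣+∣q∣; ∣p-q∣≤∣p∣+∣q∣; +-comm; +-mono-≤; +-monoˡ-≤; +-monoʳ-≤;
         module ≤-Reasoning)
import Data.Rational.Unnormalised as ℚᵘ
import Data.Rational.Unnormalised.Properties as ℚᵘ
open import Data.Rational.Solver using (module +-*-Solver)
open import Data.Vec using (Vec; []; _∷_)
open import Data.Vec.Properties using (∷-injectiveˡ; ∷-injectiveʳ)
open import Data.Product using (Σ; _×_; _,_; proj₁; proj₂)
open import Function using (_∘_)
open import Relation.Binary.PropositionalEquality

cross-mul⇒/≡ : ∀ a b m n .{{_ : NonZero m}} .{{_ : NonZero n}} →
               a ℕ.* n ≡ b ℕ.* m → + a / m ≡ + b / n
cross-mul⇒/≡ a b (suc m) (suc n) an≡bm =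
  fromℚᵘ-cong {ℚᵘ.mkℚᵘ (+ a) m} {ℚᵘ.mkℚᵘ (+ b) n} (ℚᵘ.*≡* (begin
    + a ℤ.* + suc n  ≡⟨ pos-* a (suc n) ⟨
    + (a ℕ.* suc n)  ≡⟨ cong +_ an≡bm ⟩
    + (b ℕ.* suc m)  ≡⟨ pos-* b (suc m) ⟩
    + b ℤ.* + suc m  ∎))
  where open ≡-Reasoning

/-distribʳ-+ : ∀ a b n .{{_ : NonZero n}} → + a / n + + b / n ≡ + (a ℕ.+ b) / n
/-distribʳ-+ a b (suc n) = toℚᵘ-injective (begin-equality
  toℚᵘ (+ a / suc n + + b / suc n)
    ≃⟨ toℚᵘ-homo-+ (+ a / suc n) (+ b / suc n) ⟩
  toℚᵘ (+ a / suc n) ℚᵘ.+ toℚᵘ (+ b / suc n)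
    ≃⟨ ℚᵘ.+-cong (toℚᵘ-fromℚᵘ (ℚᵘ.mkℚᵘ (+ a) n)) (toℚᵘ-fromℚᵘ (ℚᵘ.mkℚᵘ (+ b) n)) ⟩
  ℚᵘ.mkℚᵘ (+ a) n ℚᵘ.+ ℚᵘ.mkℚᵘ (+ b) n
    ≃⟨ ℚᵘ.*≡* (cross-products (+ a) (+ b) (+ suc n)) ⟩
  ℚᵘ.mkℚᵘ (+ (a ℕ.+ b)) n
    ≃⟨ toℚᵘ-fromℚᵘ (ℚᵘ.mkℚᵘ (+ (a ℕ.+ b)) n) ⟨
  toℚᵘ (+ (a ℕ.+ b) / suc n) ∎)
  where
  open ℚᵘ.≤-Reasoning
  cross-products : ∀ A B N → (A ℤ.* N ℤ.+ B ℤ.* N) ℤ.* N ≡ (A ℤ.+ B) ℤ.* (N ℤ.* N)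
  cross-products = ℤ-Solver.solve-∀

half+half : ∀ n .{{_ : NonZero n}} .{{_ : NonZero (2 ℕ.* n)}} →
            + 1 / (2 ℕ.* n) + + 1 / (2 ℕ.* n) ≡ + 1 / n
half+half n = trans (/-distribʳ-+ 1 1 (2 ℕ.* n))
                    (cross-mul⇒/≡ 2 1 (2 ℕ.* n) n (sym (ℕP.*-identityˡ (2 ℕ.* n))))

pow2neg-halves : ∀ k → pow2neg (suc k) + pow2neg (suc k) ≡ pow2neg k
pow2neg-halves k = half+half (2 ℕ.^ k) {{m^n≢0 2 k}} {{m^n≢0 2 (suc k)}}

∣p-r∣≤∣p-q∣+∣q-r∣ : ∀ p q r → ∣ p - r ∣ ℚ.≤ ∣ p - q ∣ + ∣ q - r ∣
∣p-r∣≤∣p-q∣+∣q-r∣ p q r =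
  subst (λ t → ∣ t ∣ ℚ.≤ ∣ p - q ∣ + ∣ q - r ∣) (telescope p q r) (∣p+q∣≤∣p∣+∣q∣ (p - q) (q - r))
  where
  open +-*-Solver
  telescope : ∀ p q r → (p - q) + (q - r) ≡ p - r
  telescope = solve 3 (λ p q r → (p :- q) :+ (q :- r) := p :- r) refl

∣p-q∣≤∣r-p∣+∣r-q∣ : ∀ p q r → ∣ p - q ∣ ℚ.≤ ∣ r - p ∣ + ∣ r - q ∣
∣p-q∣≤∣r-p∣+∣r-q∣ p q r = begin
  ∣ p - q ∣               ≡⟨ cong ∣_∣ (difference p q r) ⟨
  ∣ (r - q) - (r - p) ∣   ≤⟨ ∣p-q∣≤∣p∣+∣q∣ (r - q) (r - p) ⟩
  ∣ r - q ∣ + ∣ r - p ∣   ≡⟨ +-comm ∣ r - q ∣ ∣ r - p ∣ ⟩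
  ∣ r - p ∣ + ∣ r - q ∣   ∎
  where
  open ≤-Reasoning
  open +-*-Solver
  difference : ∀ p q r → (r - q) - (r - p) ≡ p - q
  difference = solve 3 (λ p q r → (r :- q) :- (r :- p) := p :- q) refl

-- At index i, compare x and y through z at the far index b = 2j+1, where j+1 = 5(i+1)
-- is chosen so that the error terms add up to exactly 2/(i+1).
distLe-triangle : ∀ {x y z q r} → distLe z x q → distLe z y r → distLe x y (q + r)
distLe-triangle {x} {y} {z} {q} {r} z≈x z≈y i = begin
  ∣ xa - ya ∣                                ≤⟨ ∣p-r∣≤∣p-q∣+∣q-r∣ xa xb ya ⟩
  ∣ xa - xb ∣ + ∣ xb - ya ∣                  ≤⟨ +-monoʳ-≤ ∣ xa - xb ∣ (∣p-r∣≤∣p-q∣+∣q-r∣ xb yb ya) ⟩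
  ∣ xa - xb ∣ + (∣ xb - yb ∣ + ∣ yb - ya ∣)  ≤⟨ +-mono-≤ (reg x a b)
                                                  (+-monoˡ-≤ ∣ yb - ya ∣ (∣p-q∣≤∣r-p∣+∣r-q∣ xb yb zb)) ⟩
  (X₁ + X₂) + ((∣ zb - xb ∣ + ∣ zb - yb ∣) + ∣ yb - ya ∣)
                                             ≤⟨ +-monoʳ-≤ (X₁ + X₂)
                                                  (+-mono-≤ (+-mono-≤ (z≈x j) (z≈y j)) (reg y b a)) ⟩
  (X₁ + X₂) + (((q + X₃) + (r + X₃)) + (X₂ + X₁))
                                             ≡⟨ regroup q r X₁ X₂ X₃ ⟩
  (q + r) + ((X₁ + X₁) + ((X₂ + X₂) + (X₃ + X₃)))
                                             ≡⟨ cong (_+_ (q + r)) error-budget ⟩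
  (q + r) + + 2 / suc i                      ∎
  where
  open ≤-Reasoning
  j = 4 ℕ.+ 5 ℕ.* i
  a = suc (2 ℕ.* i)
  b = suc (2 ℕ.* j)
  xa = seq x a
  xb = seq x b
  ya = seq y a
  yb = seq y b
  zb = seq z b
  X₁ = + 1 / suc a
  X₂ = + 1 / suc b
  X₃ = + 2 / suc j

  regroup : ∀ q r X₁ X₂ X₃ → (X₁ + X₂) + (((q + X₃) + (r + X₃)) + (X₂ + X₁))
                             ≡ (q + r) + ((X₁ + X₁) + ((X₂ + X₂) + (X₃ + X₃)))
  regroup = solve 5 (λ q r X₁ X₂ X₃ →
    (X₁ :+ X₂) :+ (((q :+ X₃) :+ (r :+ X₃)) :+ (X₂ :+ X₁))
      := (q :+ r) :+ ((X₁ :+ X₁) :+ ((X₂ :+ X₂) :+ (X₃ :+ X₃)))) refl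
    where open +-*-Solver

  halves-at : ∀ n → + 1 / suc (suc (2 ℕ.* n)) + + 1 / suc (suc (2 ℕ.* n)) ≡ + 1 / suc n
  halves-at n = trans (cong₂ _+_ half half) (half+half (suc n))
    where
    half : + 1 / suc (suc (2 ℕ.* n)) ≡ + 1 / (2 ℕ.* suc n)
    half = /-cong {+ 1} refl (sym (ℕP.*-suc 2 n))

  5[1+i]≡1+j : ∀ i → 5 ℕ.* suc i ≡ 1 ℕ.* suc (4 ℕ.+ 5 ℕ.* i)
  5[1+i]≡1+j = solve-∀

  error-budget : (X₁ + X₁) + ((X₂ + X₂) + (X₃ + X₃)) ≡ + 2 / suc i
  error-budget = begin-equality
    (X₁ + X₁) + ((X₂ + X₂) + (X₃ + X₃))
      ≡⟨ cong₂ _+_ (halves-at i) (cong₂ _+_ (halves-at j) (/-distribʳ-+ 2 2 (suc j))) ⟩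
    + 1 / suc i + (+ 1 / suc j + + 4 / suc j)
      ≡⟨ cong (_+_ (+ 1 / suc i)) (trans (/-distribʳ-+ 1 4 (suc j))
                                          (cross-mul⇒/≡ 5 1 (suc j) (suc i) (5[1+i]≡1+j i))) ⟩
    + 1 / suc i + + 1 / suc i
      ≡⟨ /-distribʳ-+ 1 1 (suc i) ⟩
    + 2 / suc i ∎

-- pad v is v followed by falses. As a function of the vector alone, G (pad (prefix α n))
-- provably depends on α only through prefix α n, without function extensionality.
pad : ∀ {n} → Vec Bool n → Cantor
pad []      _       = false
pad (b ∷ v) zero    = b
pad (b ∷ v) (suc i) = pad v i

prefix-mono : ∀ {m n} α β → m ≤ n → prefix α n ≡ prefix β n → prefix α m ≡ prefix β m
prefix-mono α β z≤n       _     = refl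
prefix-mono α β (s≤s m≤n) αn≡βn =
  cong₂ _∷_ (∷-injectiveˡ αn≡βn) (prefix-mono (α ∘ suc) (β ∘ suc) m≤n (∷-injectiveʳ αn≡βn))

prefix-pad : ∀ {m n} α → m ≤ n → prefix (pad (prefix α n)) m ≡ prefix α m
prefix-pad α z≤n       = refl
prefix-pad α (s≤s m≤n) = cong (α zero ∷_) (prefix-pad (α ∘ suc) m≤n)

search : (ℕ → Bool) → ℕ → ℕ
search P zero    = zero
search P (suc n) = if P zero then zero else suc (search (P ∘ suc) n)

search-minimal : ∀ (P : ℕ → Bool) n {m} → T (P m) → search P n ≤ m
search-minimal P zero    _ = z≤n
search-minimal P (suc n) {zero} P0 with P zero
... | true = z≤n
search-minimal P (suc n) {suc m} Pm with P zero
... | true  = z≤n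
... | false = s≤s (search-minimal (P ∘ suc) n Pm)

search-satisfies : ∀ (P : ℕ → Bool) n {m} → m ≤ n → T (P m) → T (P (search P n))
search-satisfies P zero    z≤n P0 = P0
search-satisfies P (suc n) {zero} _ P0 with P zero in P0≡true
... | true = subst T (sym P0≡true) tt
search-satisfies P (suc n) {suc m} (s≤s m≤n) Pm with P zero in P0≡true
... | true  = subst T (sym P0≡true) tt
... | false = search-satisfies (P ∘ suc) n m≤n Pm

selfModulating⇒pointwiseContinuous : ∀ {h} → SelfModulating h → PointwiseContinuous h
selfModulating⇒pointwiseContinuous {h} h-self α = h α , h-self α

module SelfModulus (G : Cantor → ℕ) (G-continuous : PointwiseContinuous G) where

  sufficient : Cantor → ℕ → Bool
  sufficient α n = G (pad (prefix α n)) ≤ᵇ n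

  sufficient-cong : ∀ α β {n} → prefix α n ≡ prefix β n → sufficient α n ≡ sufficient β n
  sufficient-cong α β {n} αn≡βn = cong (λ v → G (pad v) ≤ᵇ n) αn≡βn

  bound : Cantor → ℕ
  bound α = G α ⊔ proj₁ (G-continuous α)

  sufficient-bound : ∀ α → T (sufficient α (bound α))
  sufficient-bound α = ≤⇒≤ᵇ (subst (_≤ bound α) G-padded≡G (m≤m⊔n (G α) c))
    where
    c = proj₁ (G-continuous α)
    G-padded≡G : G α ≡ G (pad (prefix α (bound α)))
    G-padded≡G = proj₂ (G-continuous α) _ (sym (prefix-pad α (m≤n⊔m (G α) c)))

  selfModulus : Cantor → ℕ
  selfModulus α = search (sufficient α) (bound α)

  sufficient-selfModulus : ∀ α → T (sufficient α (selfModulus α))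
  sufficient-selfModulus α = search-satisfies (sufficient α) (bound α) ≤-refl (sufficient-bound α)

  G-pad-selfModulus≤selfModulus : ∀ α → G (pad (prefix α (selfModulus α))) ≤ selfModulus α
  G-pad-selfModulus≤selfModulus α = ≤ᵇ⇒≤ _ _ (sufficient-selfModulus α)

  selfModulus-least : ∀ {α n} → T (sufficient α n) → selfModulus α ≤ n
  selfModulus-least {α} = search-minimal (sufficient α) (bound α)

  selfModulus-selfModulating : SelfModulating selfModulus
  selfModulus-selfModulating α β αs≡βs = ≤-antisym sα≤sβ sβ≤sα
    where
    sβ≤sα : selfModulus β ≤ selfModulus α
    sβ≤sα = selfModulus-least (subst T (sufficient-cong α β αs≡βs) (sufficient-selfModulus α))
    sα≤sβ : selfModulus α ≤ selfModulus β
    sα≤sβ = selfModulus-least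
      (subst T (sym (sufficient-cong α β (prefix-mono α β sβ≤sα αs≡βs))) (sufficient-selfModulus β))

open SelfModulus using (selfModulus; selfModulus-selfModulating)

selfModulus-isModulus : ∀ {f g} (cm : ContinuousModulus f g) →
                        IsModulus f (λ k → selfModulus (g (suc k)) (proj₂ cm (suc k)))
selfModulus-isModulus {f} {g} (g-modulus , g-continuous) k α β αs≡βs =
  subst (distLe (f α) (f β)) (pow2neg-halves k)
        (distLe-triangle {f α} {f β} {f γ} {pow2neg (suc k)} {pow2neg (suc k)}
                         (g-modulus (suc k) γ α γ≈α) (g-modulus (suc k) γ β γ≈β))
  where
  open SelfModulus (g (suc k)) (g-continuous (suc k))
    using (G-pad-selfModulus≤selfModulus) renaming (selfModulus to s)
  γ : Cantor
  γ = pad (prefix α (s α))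
  Gγ≤s : g (suc k) γ ≤ s α
  Gγ≤s = G-pad-selfModulus≤selfModulus α
  γ≈α : prefix γ (g (suc k) γ) ≡ prefix α (g (suc k) γ)
  γ≈α = prefix-pad α Gγ≤s
  γ≈β : prefix γ (g (suc k) γ) ≡ prefix β (g (suc k) γ)
  γ≈β = trans γ≈α (prefix-mono α β Gγ≤s αs≡βs)

lemma3p4 : (f : Cantor → ℝ) → Σ (ℕ → Cantor → ℕ) (λ g → ContinuousModulus f g)
    → Σ (ℕ → Cantor → ℕ) (λ g → ContinuousModulus f g × (∀ k → SelfModulating (g k)))
lemma3p4 f (g , cm) =
  g′ , (selfModulus-isModulus {f} {g} cm , λ k → selfModulating⇒pointwiseContinuous (g′-self k)) , g′-self
  where
  g′ : ℕ → Cantor → ℕ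
  g′ k = selfModulus (g (suc k)) (proj₂ cm (suc k))
  g′-self : ∀ k → SelfModulating (g′ k)
  g′-self k = selfModulus-selfModulating (g (suc k)) (proj₂ cm (suc k))
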